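{- Let $G$ be a graph with property $(*)$. Every integer point of the Newton polytope $\mathrm{Newton}(D_G)$ is a vertex.
   Context: Property $(*)$: $G$ is a finite connected bipartite plane graph with fixed proper black/white coloring, every edge lying in some perfect matching. An edge of a bounded face $f$ is black-white if going clockwise around $f$ one meets its black endpoint first, white-black otherwise. Down-flip at $f$: if a perfect matching contains all black-white edges of $f$, replace them with the white-black edges (inverse: up-flip). Perfect matchings with $M\le M'$ iff $M$ is obtained from $M'$ by down-flips form a distributive lattice with minimum $\hat0$. For a saturated chain $\hat0=M_0\lessdot\cdots\lessdot M_\ell=M$ with $M_{i-1},M_i$ related by a flip at $f_i$, $\mathrm{mrk}(M)=y_{f_1}\cdots y_{f_\ell}$ (chain-independent); $D_G=\sum_M\mathrm{mrk}(M)$, a polynomial in variables $y_f$ indexed by bounded faces. The Newton polytope is the convex hull in $\mathbb{R}^{\mathrm{faces}(G)}$ of the exponent vectors of monomials with nonzero coefficient.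
   Formalization: Membership in $\mathrm{Newton}(D_G)$ uses convex combinations with rational rather than real coefficients, and being a vertex is tested only against rational points and rational weights. -}

module Defs where

open import Data.Nat as ℕ using (ℕ; zero; suc)
open import Data.Fin using (Fin; toℕ; _≟_)
open import Data.Bool using (Bool; true; false; not)
open import Data.List using (List; []; _∷_; foldr)
open import Data.List.Relation.Unary.All using (All)
open import Data.Product using (Σ; _×_; _,_; proj₁; ∃)
open import Data.Sum using (_⊎_)
open import Data.Integer using (ℤ)
open import Data.Rational using (ℚ; 0ℚ; 1ℚ; _/_; _+_; _*_; _-_; _≤_; _<_)
open import Relation.Nullary using (¬_; yes; no)
open import Relation.Binary.PropositionalEquality using (_≡_)
open import Function.Bundles using (_⇔_)

iter : {n : ℕ} → (Fin n → Fin n) → ℕ → Fin n → Fin n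
iter f zero    d = d
iter f (suc k) d = f (iter f k d)

SameOrbit : {n : ℕ} → (Fin n → Fin n) → Fin n → Fin n → Set
SameOrbit f d e = ∃ λ k → iter f k d ≡ e

IsRep : {n : ℕ} → (Fin n → Fin n) → Fin n → Set
IsRep f d = ∀ k → toℕ d ℕ.≤ toℕ (iter f k d)

-- computable count of the orbits of f (orbits of a permutation of Fin n
-- have length ≤ n, so checking the first n iterates suffices)
private
  allBelow : {n : ℕ} → (Fin n → Fin n) → Fin n → ℕ → Bool
  allBelow f d zero    = true
  allBelow f d (suc k) with toℕ d ℕ.≤? toℕ (iter f k d)
  ... | yes _ = allBelow f d k
  ... | no  _ = false

  countFin : (n : ℕ) → (Fin n → Bool) → ℕ
  countFin zero    p = zero
  countFin (suc n) p with p Fin.zero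
  ... | true  = suc (countFin n (λ i → p (Fin.suc i)))
  ... | false = countFin n (λ i → p (Fin.suc i))

numOrbits : {n : ℕ} → (Fin n → Fin n) → ℕ
numOrbits {n} f = countFin n (λ d → allBelow f d n)

-- Plane graphs as combinatorial maps (rotation systems) on the sphere.
--   darts  : Fin nD (each edge = two darts)
--   α      : fixed-point-free involution pairing the two darts of an edge
--   σ      : permutation rotating the darts around their tail vertex
--            COUNTERCLOCKWISE; vertices = σ-orbits
--   φ d = σ (α d) : faces = φ-orbits; φ traverses the boundary of the face
--            lying to the right of each dart, i.e. bounded faces CLOCKWISE
--   outer  : a dart on the unbounded face
--   colour : true = black, false = white (colour of the tail vertex)

record PlaneBipartiteGraph : Set where
  field
    nD     : ℕ
    α      : Fin nD → Fin nD
    σ      : Fin nD → Fin nD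
    outer  : Fin nD
    colour : Fin nD → Bool

  φ : Fin nD → Fin nD
  φ d = σ (α d)

  Dart : Set
  Dart = Fin nD

  numV numE numF : ℕ
  numV = numOrbits σ
  numE = numOrbits α
  numF = numOrbits φ

data Reach {n : ℕ} (α σ : Fin n → Fin n) : Fin n → Fin n → Set where
  here  : ∀ {d} → Reach α σ d d
  viaσ  : ∀ {d e} → Reach α σ (σ d) e → Reach α σ d e
  viaα  : ∀ {d e} → Reach α σ (α d) e → Reach α σ d e

module _ (G : PlaneBipartiteGraph) where
  open PlaneBipartiteGraph G

  IsConnectedPlaneBipartite : Set
  IsConnectedPlaneBipartite =
      (∀ d → α (α d) ≡ d)
    × (∀ d → ¬ (α d ≡ d))
    × (∀ d e → σ d ≡ σ e → d ≡ e)
    × (∀ d e → Reach α σ d e)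
    × (numV ℕ.+ numF ≡ numE ℕ.+ 2)                 -- Euler: plane embedding
    × (∀ d → colour (σ d) ≡ colour d)
    × (∀ d → colour (α d) ≡ not (colour d))

  Matching : Set
  Matching = Dart → Bool

  -- perfect matching: set of edges (α-invariant set of darts) such that each
  -- vertex (σ-orbit) carries exactly one matched dart
  IsPM : Matching → Set
  IsPM M = (∀ d → M (α d) ≡ M d)
         × (∀ d → ∃ λ k → M (iter σ k d) ≡ true)
         × (∀ d j k → M (iter σ j d) ≡ true → M (iter σ k d) ≡ true
                    → iter σ j d ≡ iter σ k d)

  Star : Set
  Star = IsConnectedPlaneBipartite
       × (∀ d → ∃ λ M → IsPM M × M d ≡ true)

  -- bounded faces, indexed by their canonical representative dart
  Face : Set
  Face = Σ Dart λ r → IsRep φ r × ¬ SameOrbit φ outer r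

  -- the edge of dart d is a black-white (resp. white-black) edge of face f:
  -- one of its darts lies on the clockwise boundary walk of f and its tail
  -- (the endpoint met first) is black (resp. white)
  BW WB : Face → Dart → Set
  BW f d = (SameOrbit φ (proj₁ f) d × colour d ≡ true)
         ⊎ (SameOrbit φ (proj₁ f) (α d) × colour (α d) ≡ true)
  WB f d = (SameOrbit φ (proj₁ f) d × colour d ≡ false)
         ⊎ (SameOrbit φ (proj₁ f) (α d) × colour (α d) ≡ false)

  DownFlip : Face → Matching → Matching → Set
  DownFlip f M M' = (∀ d → BW f d → M d ≡ true)
                  × (∀ d → (M' d ≡ true) ⇔ (WB f d ⊎ (M d ≡ true × ¬ BW f d)))

  _≐_ : Matching → Matching → Set
  M ≐ N = ∀ d → M d ≡ N d

  data _≼_ : Matching → Matching → Set where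
    done : ∀ {M M'} → M ≐ M' → M ≼ M'
    step : ∀ {M M' N} f → DownFlip f M' N → M ≼ N → M ≼ M'

  _⋖_ : Matching → Matching → Set
  M ⋖ N = M ≼ N × ¬ (M ≐ N)
        × (∀ K → IsPM K → M ≼ K → K ≼ N → K ≐ M ⊎ K ≐ N)

  IsMinimum : Matching → Set
  IsMinimum Z = IsPM Z × (∀ M → IsPM M → Z ≼ M)

  -- saturated chain Z = M₀ ⋖ … ⋖ Mℓ = M, with list of flip faces f_ℓ … f_1
  data SatChain (Z : Matching) : Matching → List Face → Set where
    start : ∀ {M} → M ≐ Z → SatChain Z M []
    next  : ∀ {N M fs} f → SatChain Z N fs → IsPM N → N ⋖ M
          → DownFlip f M N → SatChain Z M (f ∷ fs)

  mult : List Face → Face → ℕ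
  mult []        f = zero
  mult (g ∷ gs)  f with proj₁ g ≟ proj₁ f
  ... | yes _ = suc (mult gs f)
  ... | no  _ = mult gs f

  ExpVec : Set
  ExpVec = Face → ℕ

  -- v is the exponent vector of mrk(M) for some perfect matching M,
  -- i.e. of a monomial of D_G (all coefficients of D_G are positive)
  InSupport : ExpVec → Set
  InSupport v = Σ Matching λ Z → IsMinimum Z
              × Σ Matching λ M → IsPM M
              × Σ (List Face) λ fs → SatChain Z M fs × (∀ f → v f ≡ mult fs f)

  Point : Set
  Point = Face → ℚ

  ℕtoℚ : ℕ → ℚ
  ℕtoℚ n = ℤ.+ n / 1
    where import Data.Integer as ℤ

  ℤtoℚ : ℤ → ℚ
  ℤtoℚ z = z / 1

  InNewton : Point → Set
  InNewton x = Σ (List (ℚ × ExpVec)) λ L →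
      All (λ p → (0ℚ ≤ proj₁ p) × InSupport (Data.Product.proj₂ p)) L
    × foldr (λ p acc → proj₁ p + acc) 0ℚ L ≡ 1ℚ
    × (∀ f → x f ≡ foldr (λ p acc → proj₁ p * ℕtoℚ (Data.Product.proj₂ p f) + acc) 0ℚ L)

  IsVertex : Point → Set
  IsVertex x = InNewton x
    × (∀ a b t → InNewton a → InNewton b → 0ℚ < t → t < 1ℚ
         → (∀ f → x f ≡ t * a f + (1ℚ - t) * b f) → ∀ f → a f ≡ b f)

{-# OPTIONS --safe #-}
-- Read a point w of Newton(D_G) as a function ŵ on darts: the value of w at the face to the
-- right of the dart, and 0 on the outer face.  Each flip at f in a saturated chain from the
-- minimum Z up to M raises ŵ by one on the darts of f while exchanging the black-white and
-- white-black edges of f, so the exponent vector of mrk(M) satisfies, at every black dart y,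
--   ŵ(y) - ŵ(σ y) + [y ∈ Z] = [y ∈ M].
-- (The same count shows that a cycle of down-flips M ≥ M′ ≥ M flips nowhere, so the minimum is
-- unique.)  Hence the affine map w ↦ (ŵ(y) - ŵ(σ y) + [y ∈ Z])_y sends Newton(D_G) into the
-- unit cube, and it is injective there: a difference of two points with the same image is
-- constant on faces and across black darts, hence, G being connected, equal to its value 0 on
-- the outer face.  An integer point is sent to a 0/1 vector, a vertex of the cube, so it is a
-- vertex of Newton(D_G).
module Submission where

open import Defs

open import Data.Bool using (Bool; true; false; not; _∧_; _∨_)
open import Data.Empty using (⊥-elim)
open import Data.Fin using (Fin; toℕ)
import Data.Fin as Fin
open import Data.Integer using (ℤ)
open import Data.List using (List; []; _∷_; foldr)
open import Data.List.Relation.Unary.All using (All; []; _∷_)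
import Data.List.Relation.Unary.All as All
open import Data.Nat using (ℕ; zero; suc)
open import Data.Product using (Σ; _×_; _,_; proj₁; proj₂; ∃)
open import Data.Sum using (_⊎_; inj₁; inj₂; [_,_])
open import Function using (_∘_)
open import Relation.Nullary using (¬_; Dec; yes; no)
open import Relation.Binary.PropositionalEquality hiding ([_])

module _ where
  open import Data.Bool.Properties using (¬-not)
  open import Data.Fin.Properties using (pigeonhole; toℕ-injective)
  open import Data.List using (applyUpTo; map)
  open import Data.List.Extrema.Nat using (argmin; argmin-all; f[argmin]≤f[xs])
  open import Data.List.Membership.Propositional using (_∈_)
  open import Data.List.Membership.Propositional.Properties using (∈-applyUpTo⁺; ∈-applyUpTo⁻)
  import Data.List.Membership.DecPropositional as DecMembership
  open import Data.Nat using (_+_; _*_; _∸_; _≤_; z≤n; s≤s)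
  open import Data.Nat.DivMod using (_%_; _/_; m≡m%n+[m/n]*n; m%n<n)
  open import Data.Nat.ListAction using (sum)
  open import Data.Nat.Properties
  open import Algebra.Properties.CommutativeSemigroup +-commutativeSemigroup using (x∙yz≈y∙xz; x∙yz≈yx∙z)
  open import Function.Bundles using (module Equivalence)
  open import Relation.Nullary.Decidable using (map′; does; dec-true; dec-false)

  bit : Bool → ℕ
  bit true  = 1
  bit false = 0

  flip-count-≤ : ∀ a c m → (a ≡ true → m ≡ true) → bit a + bit (c ∨ (not a ∧ m)) ≤ bit c + bit m
  flip-count-≤ true  true  true  _   = ≤-refl
  flip-count-≤ true  false true  _   = ≤-refl
  flip-count-≤ true  _     false a⇒m with () ← a⇒m refl
  flip-count-≤ false true  m     _   = s≤s z≤n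
  flip-count-≤ false false m     _   = ≤-refl

  flip-count-≡ : ∀ a c m → (a ≡ true → m ≡ true) → (c ≡ true → m ≡ true → a ≡ true)
               → bit a + bit (c ∨ (not a ∧ m)) ≡ bit c + bit m
  flip-count-≡ true  true  true  _   _     = refl
  flip-count-≡ true  false true  _   _     = refl
  flip-count-≡ true  _     false a⇒m _     with () ← a⇒m refl
  flip-count-≡ false true  true  _   c∧m⇒a with () ← c∧m⇒a refl refl
  flip-count-≡ false true  false _   _     = refl
  flip-count-≡ false false m     _   _     = refl

  true⇔true⇒≡ : ∀ {a b} → (a ≡ true → b ≡ true) → (b ≡ true → a ≡ true) → a ≡ b
  true⇔true⇒≡ {true}  a⇒b _   = sym (a⇒b refl)
  true⇔true⇒≡ {false} {true} _ b⇒a = b⇒a refl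
  true⇔true⇒≡ {false} {false} _ _ = refl

  bit-injective : ∀ {a b} → bit a ≤ bit b → bit b ≤ bit a → a ≡ b
  bit-injective {true}  {true}  _ _ = refl
  bit-injective {true}  {false} ()
  bit-injective {false} {true}  _ ()
  bit-injective {false} {false} _ _ = refl

  telescope-≤ : ∀ a a′ b b′ {m n z} → a + z ≤ a′ + n → b + n ≤ b′ + m → (b + a) + z ≤ (b′ + a′) + m
  telescope-≤ a a′ b b′ {m} {n} {z} a≤ b≤ = begin
    (b + a) + z   ≡⟨ +-assoc b a z ⟩
    b + (a + z)   ≤⟨ +-monoʳ-≤ b a≤ ⟩
    b + (a′ + n)  ≡⟨ x∙yz≈y∙xz b a′ n ⟩
    a′ + (b + n)  ≤⟨ +-monoʳ-≤ a′ b≤ ⟩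
    a′ + (b′ + m) ≡⟨ x∙yz≈yx∙z a′ b′ m ⟩
    (b′ + a′) + m ∎
    where open ≤-Reasoning

  telescope-≡ : ∀ a a′ b b′ {m n z} → a + z ≡ a′ + n → b + n ≡ b′ + m → (b + a) + z ≡ (b′ + a′) + m
  telescope-≡ a a′ b b′ {m} {n} {z} a≡ b≡ = begin
    (b + a) + z   ≡⟨ +-assoc b a z ⟩
    b + (a + z)   ≡⟨ cong (b +_) a≡ ⟩
    b + (a′ + n)  ≡⟨ x∙yz≈y∙xz b a′ n ⟩
    a′ + (b + n)  ≡⟨ cong (a′ +_) b≡ ⟩
    a′ + (b′ + m) ≡⟨ x∙yz≈yx∙z a′ b′ m ⟩
    (b′ + a′) + m ∎
    where open ≡-Reasoning

  module Orbits {n : ℕ} (f : Fin n → Fin n) (f-injective : ∀ {a b} → f a ≡ f b → a ≡ b) where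

    open DecMembership (Fin._≟_ {n}) using (_∈?_)

    iter-+ : ∀ j k d → iter f (j + k) d ≡ iter f j (iter f k d)
    iter-+ zero    k d = refl
    iter-+ (suc j) k d = cong f (iter-+ j k d)

    iter-injective : ∀ k {d e} → iter f k d ≡ iter f k e → d ≡ e
    iter-injective zero    eq = eq
    iter-injective (suc k) eq = iter-injective k (f-injective eq)

    iter-periodic : ∀ {p d} → iter f p d ≡ d → ∀ m → iter f (m * p) d ≡ d
    iter-periodic         eq zero    = refl
    iter-periodic {p} {d} eq (suc m) = begin
      iter f (p + m * p) d       ≡⟨ iter-+ p (m * p) d ⟩
      iter f p (iter f (m * p) d) ≡⟨ cong (iter f p) (iter-periodic eq m) ⟩
      iter f p d                 ≡⟨ eq ⟩
      d                          ∎
      where open ≡-Reasoning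

    -- Opaque: unfolding the pigeonhole and argmin searches makes with-abstraction over orbits very slow.
    opaque
      period : ∀ d → ∃ λ q → iter f (suc q) d ≡ d
      period d with pigeonhole (n<1+n n) (λ i → iter f (toℕ i) d)
      ... | i , j , i<j , iᵢ≡iⱼ = toℕ j ∸ suc (toℕ i) , sym (iter-injective (toℕ i) (begin
        iter f (toℕ i) d                                    ≡⟨ iᵢ≡iⱼ ⟩
        iter f (toℕ j) d                                    ≡⟨ cong (λ k → iter f k d) j≡ ⟩
        iter f (toℕ i + suc (toℕ j ∸ suc (toℕ i))) d         ≡⟨ iter-+ (toℕ i) _ d ⟩
        iter f (toℕ i) (iter f (suc (toℕ j ∸ suc (toℕ i))) d) ∎))
        where
        open ≡-Reasoning
        j≡ : toℕ j ≡ toℕ i + suc (toℕ j ∸ suc (toℕ i))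
        j≡ = trans (sym (m+[n∸m]≡n (<⇒≤ i<j))) (cong (toℕ i +_) (+-∸-assoc 1 i<j))

    iter-mod : ∀ {q d} → iter f (suc q) d ≡ d → ∀ k → iter f k d ≡ iter f (k % suc q) d
    iter-mod {q} {d} eq k = begin
      iter f k d                                              ≡⟨ cong (λ m → iter f m d) (m≡m%n+[m/n]*n k (suc q)) ⟩
      iter f (k % suc q + (k / suc q) * suc q) d             ≡⟨ iter-+ (k % suc q) _ d ⟩
      iter f (k % suc q) (iter f ((k / suc q) * suc q) d)    ≡⟨ cong (iter f (k % suc q)) (iter-periodic eq (k / suc q)) ⟩
      iter f (k % suc q) d                                    ∎
      where open ≡-Reasoning

    orbit-step : ∀ d → SameOrbit f d (f d)
    orbit-step d = 1 , refl

    orbit-trans : ∀ {d e g} → SameOrbit f d e → SameOrbit f e g → SameOrbit f d g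
    orbit-trans {d} (j , refl) (k , refl) = k + j , iter-+ k j d

    orbit-sym : ∀ {d e} → SameOrbit f d e → SameOrbit f e d
    orbit-sym {d} (k , refl) with period d
    ... | q , eq = k * q , (begin
      iter f (k * q) (iter f k d) ≡⟨ iter-+ (k * q) k d ⟨
      iter f (k * q + k) d        ≡⟨ cong (λ m → iter f m d) (trans (+-comm (k * q) k) (sym (*-suc k q))) ⟩
      iter f (k * suc q) d        ≡⟨ iter-periodic eq k ⟩
      d                           ∎)
      where open ≡-Reasoning

    orbit : Fin n → List (Fin n)
    orbit d = applyUpTo (λ k → iter f k d) (suc (proj₁ (period d)))

    ∈-orbit⁺ : ∀ {d e} → SameOrbit f d e → e ∈ orbit d
    ∈-orbit⁺ {d} (k , refl) = subst (_∈ orbit d) (sym (iter-mod (proj₂ (period d)) k))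
      (∈-applyUpTo⁺ (λ k → iter f k d) (m%n<n k _))

    ∈-orbit⁻ : ∀ {d e} → e ∈ orbit d → SameOrbit f d e
    ∈-orbit⁻ {d} e∈ with ∈-applyUpTo⁻ (λ k → iter f k d) e∈
    ... | k , _ , e≡ = k , sym e≡

    opaque
      sameOrbit? : ∀ d e → Dec (SameOrbit f d e)
      sameOrbit? d e = map′ ∈-orbit⁻ ∈-orbit⁺ (e ∈? orbit d)

    opaque
      rep : Fin n → Fin n
      rep d = argmin toℕ d (orbit d)

      rep-orbit : ∀ d → SameOrbit f (rep d) d
      rep-orbit d = orbit-sym (argmin-all toℕ {P = SameOrbit f d} (0 , refl) (All.tabulate ∈-orbit⁻))

      rep-isRep : ∀ d → IsRep f (rep d)
      rep-isRep d k = All.lookup (f[argmin]≤f[xs] {f = toℕ} d (orbit d))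
        (∈-orbit⁺ (orbit-trans (orbit-sym (rep-orbit d)) (k , refl)))

    rep-unique : ∀ {r r′} → IsRep f r → IsRep f r′ → SameOrbit f r r′ → r ≡ r′
    rep-unique {r} r-rep r′-rep (k , refl) with orbit-sym (k , refl)
    ... | j , eq = toℕ-injective (≤-antisym (r-rep k) (subst (λ e → toℕ (iter f k r) ≤ toℕ e) eq (r′-rep j)))

    nondecreasing⇒invariant : ∀ {P : Fin n → Set} → (∀ {d} → P d → P (f d))
      → (g : Fin n → ℕ) → (∀ {d} → P d → g d ≤ g (f d)) → ∀ {d} → P d → g d ≡ g (f d)
    nondecreasing⇒invariant {P} P-closed g g-mono {d} Pd with period d
    ... | q , eq = ≤-antisym (g-mono Pd) (subst (λ e → g (f d) ≤ g e) eq (climb q))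
      where
      P-iter : ∀ k → P (iter f k d)
      P-iter zero    = Pd
      P-iter (suc k) = P-closed (P-iter k)
      climb : ∀ k → g (f d) ≤ g (iter f (suc k) d)
      climb zero    = ≤-refl
      climb (suc k) = ≤-trans (climb k) (g-mono (P-iter (suc k)))

  module _ (G : PlaneBipartiteGraph) where
    open PlaneBipartiteGraph G
    open Equivalence

    module Heights (α-involutive : ∀ d → α (α d) ≡ d)
               (σ-injective : ∀ d e → σ d ≡ σ e → d ≡ e)
               (connected : ∀ d e → Reach α σ d e)
               (colour-σ : ∀ d → colour (σ d) ≡ colour d)
               (colour-α : ∀ d → colour (α d) ≡ not (colour d)) where

      Black : Dart → Set
      Black d = colour d ≡ true

      φ-injective : ∀ {d e} → φ d ≡ φ e → d ≡ e
      φ-injective {d} {e} eq = trans (sym (α-involutive d)) (trans (cong α (σ-injective _ _ eq)) (α-involutive e))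

      open Orbits φ φ-injective
      module Vertices = Orbits σ (σ-injective _ _)

      α-orbit-σ : ∀ d → SameOrbit φ (α d) (σ d)
      α-orbit-σ d = 1 , cong σ (α-involutive d)

      invariant⇒constant : ∀ {A : Set} (h : Dart → A) → (∀ d → h (φ d) ≡ h d)
                         → (∀ {y} → Black y → h y ≡ h (σ y)) → ∀ d → h d ≡ h outer
      invariant⇒constant h h-φ h-black d = along (connected d outer)
        where
        h-σ : ∀ d → h (σ d) ≡ h d
        h-σ d with colour d in c
        ... | true  = sym (h-black c)
        ... | false = begin
          h (σ d)         ≡⟨ cong (h ∘ σ) (α-involutive d) ⟨
          h (φ (α d))     ≡⟨ h-φ (α d) ⟩
          h (α d)         ≡⟨ h-black (trans (colour-α d) (cong not c)) ⟩
          h (φ d)         ≡⟨ h-φ d ⟩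
          h d             ∎
          where open ≡-Reasoning
        h-α : ∀ d → h (α d) ≡ h d
        h-α d = trans (sym (h-φ (α d))) (trans (cong (h ∘ σ) (α-involutive d)) (h-σ d))
        along : ∀ {d e} → Reach α σ d e → h d ≡ h e
        along here     = refl
        along (viaσ r) = trans (sym (h-σ _)) (along r)
        along (viaα r) = trans (sym (h-α _)) (along r)

      _∈ᶠ_ : Dart → Face G → Set
      d ∈ᶠ F = SameOrbit φ (proj₁ F) d

      _∈ᶠ?_ : ∀ d F → Dec (d ∈ᶠ F)
      d ∈ᶠ? F = sameOrbit? (proj₁ F) d

      face-unique : ∀ {F F′ d} → d ∈ᶠ F → d ∈ᶠ F′ → proj₁ F ≡ proj₁ F′
      face-unique {F} {F′} d∈F d∈F′ = rep-unique (proj₁ (proj₂ F)) (proj₁ (proj₂ F′)) (orbit-trans d∈F (orbit-sym d∈F′))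

      ∈ᶠ⇒bounded : ∀ F {d} → d ∈ᶠ F → ¬ SameOrbit φ outer d
      ∈ᶠ⇒bounded F d∈F outer~d = proj₂ (proj₂ F) (orbit-trans outer~d (orbit-sym d∈F))

      data Location (d : Dart) : Set where
        bounded   : (F : Face G) → d ∈ᶠ F → Location d
        unbounded : SameOrbit φ outer d → Location d

      opaque
        locate : ∀ d → Location d
        locate d with sameOrbit? outer (rep d)
        ... | yes outer~r = unbounded (orbit-trans outer~r (rep-orbit d))
        ... | no  ¬outer~r = bounded (rep d , rep-isRep d , ¬outer~r) (rep-orbit d)

      extend : {A : Set} → A → (Face G → A) → Dart → A
      extend z w d with locate d
      ... | bounded F _ = w F
      ... | unbounded _ = z

      -- Face G contains proofs that are functions, so two faces with the same representative
      -- dart need not be equal without function extensionality.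
      RespectsRep : {A : Set} → (Face G → A) → Set
      RespectsRep w = ∀ {F F′} → proj₁ F ≡ proj₁ F′ → w F ≡ w F′

      extend-face : ∀ {A z} {w : Face G → A} → RespectsRep w → ∀ {F d} → d ∈ᶠ F → extend z w d ≡ w F
      extend-face w-resp {F} {d} d∈F with locate d
      ... | bounded F′ d∈F′  = w-resp (face-unique {F′} {F} d∈F′ d∈F)
      ... | unbounded outer~d = ⊥-elim (∈ᶠ⇒bounded F d∈F outer~d)

      extend-outer : ∀ {A z} {w : Face G → A} {d} → SameOrbit φ outer d → extend z w d ≡ z
      extend-outer {d = d} outer~d with locate d
      ... | bounded F d∈F = ⊥-elim (∈ᶠ⇒bounded F d∈F outer~d)
      ... | unbounded _   = refl

      extend-φ : ∀ {A z} {w : Face G → A} → RespectsRep w → ∀ d → extend z w (φ d) ≡ extend z w d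
      extend-φ w-resp d with locate d
      ... | bounded F d∈F     = extend-face w-resp (orbit-trans d∈F (orbit-step d))
      ... | unbounded outer~d = extend-outer (orbit-trans outer~d (orbit-step d))

      extend-map : ∀ {A B : Set} (g : A → B) {z w} d → extend (g z) (g ∘ w) d ≡ g (extend z w d)
      extend-map g d with locate d
      ... | bounded _ _ = refl
      ... | unbounded _ = refl

      onFace : Face G → Dart → Bool
      onFace F d = does (d ∈ᶠ? F)

      onFace-true : ∀ F {d} → d ∈ᶠ F → onFace F d ≡ true
      onFace-true F {d} = dec-true (d ∈ᶠ? F)

      onFace-false : ∀ F {d} → ¬ d ∈ᶠ F → onFace F d ≡ false
      onFace-false F {d} = dec-false (d ∈ᶠ? F)

      onFace-orbit : ∀ F {d e} → SameOrbit φ d e → onFace F d ≡ onFace F e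
      onFace-orbit F {d} d~e with d ∈ᶠ? F
      ... | yes d∈F = sym (onFace-true F (orbit-trans d∈F d~e))
      ... | no  d∉F = sym (onFace-false F (d∉F ∘ λ e∈F → orbit-trans e∈F (orbit-sym d~e)))

      flips : List (Face G) → Dart → ℕ
      flips fs d = sum (map (λ F → bit (onFace F d)) fs)

      flips-orbit : ∀ fs {d e} → SameOrbit φ d e → flips fs d ≡ flips fs e
      flips-orbit []       d~e = refl
      flips-orbit (F ∷ fs) d~e = cong₂ _+_ (cong bit (onFace-orbit F d~e)) (flips-orbit fs d~e)

      flips-outer : ∀ fs {d} → SameOrbit φ outer d → flips fs d ≡ 0
      flips-outer []       outer~d = refl
      flips-outer (F ∷ fs) {d} outer~d
        rewrite onFace-false F (λ d∈F → ∈ᶠ⇒bounded F d∈F outer~d) = flips-outer fs outer~d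

      mult-flips : ∀ fs F → mult G fs F ≡ flips fs (proj₁ F)
      mult-flips []       F = refl
      mult-flips (F′ ∷ fs) F with proj₁ F′ Fin.≟ proj₁ F
      ... | yes r′≡r rewrite onFace-true F′ (0 , r′≡r) = cong suc (mult-flips fs F)
      ... | no  r′≢r rewrite onFace-false F′ (λ r∈F′ → r′≢r (face-unique {F′} {F} r∈F′ (0 , refl))) = mult-flips fs F

      onFace-true⁻ : ∀ F {d} → onFace F d ≡ true → d ∈ᶠ F
      onFace-true⁻ F {d} on with d ∈ᶠ? F
      ... | yes d∈F = d∈F
      ... | no  _ with () ← on

      σ-black : ∀ {y} → Black y → Black (σ y)
      σ-black {y} black = trans (colour-σ y) black

      α-white : ∀ {y} → Black y → colour (α y) ≡ false
      α-white {y} black = trans (colour-α y) (cong not black)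

      module _ {F : Face G} {y : Dart} (black : Black y) where

        BW⇒∈ᶠ : BW G F y → y ∈ᶠ F
        BW⇒∈ᶠ (inj₁ (y∈F , _))        = y∈F
        BW⇒∈ᶠ (inj₂ (_ , αy-black)) with () ← trans (sym αy-black) (α-white black)

        ∈ᶠ⇒BW : y ∈ᶠ F → BW G F y
        ∈ᶠ⇒BW y∈F = inj₁ (y∈F , black)

        WB⇒σ∈ᶠ : WB G F y → σ y ∈ᶠ F
        WB⇒σ∈ᶠ (inj₁ (_ , y-white)) with () ← trans (sym black) y-white
        WB⇒σ∈ᶠ (inj₂ (αy∈F , _))    = orbit-trans αy∈F (α-orbit-σ y)

        σ∈ᶠ⇒WB : σ y ∈ᶠ F → WB G F y
        σ∈ᶠ⇒WB σy∈F = inj₂ (orbit-trans σy∈F (orbit-sym (α-orbit-σ y)) , α-white black)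

      matched-on-face : ∀ F {M N y} → DownFlip G F M N → Black y → onFace F y ≡ true → M y ≡ true
      matched-on-face F {y = y} (BW-matched , _) black on = BW-matched y (∈ᶠ⇒BW {F} black (onFace-true⁻ F on))

      flipped-at-black : ∀ F {M N y} → DownFlip G F M N → Black y
                       → N y ≡ onFace F (σ y) ∨ (not (onFace F y) ∧ M y)
      flipped-at-black F {M} {N} {y} (_ , N⇔) black with y ∈ᶠ? F | σ y ∈ᶠ? F
      ... | _       | yes σy∈F =
        from (N⇔ y) (inj₁ (σ∈ᶠ⇒WB {F} black σy∈F))
      ... | yes y∈F | no σy∉F =
        ¬-not λ Ny → [ σy∉F ∘ WB⇒σ∈ᶠ {F} black , (λ (_ , ¬BW) → ¬BW (∈ᶠ⇒BW {F} black y∈F)) ] (to (N⇔ y) Ny)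
      ... | no y∉F  | no σy∉F =
        true⇔true⇒≡ (λ Ny → [ ⊥-elim ∘ σy∉F ∘ WB⇒σ∈ᶠ {F} black , proj₁ ] (to (N⇔ y) Ny))
                    (λ My → from (N⇔ y) (inj₂ (My , y∉F ∘ BW⇒∈ᶠ {F} black)))

      -- Both y and σ y would be matched darts at the tail of y.
      perfect-on-face : ∀ F {M N y} → IsPM G M → DownFlip G F M N → Black y → σ y ∈ᶠ F → M y ≡ true → y ∈ᶠ F
      perfect-on-face F {y = y} (_ , _ , unique) (BW-matched , _) black σy∈F My =
        subst (_∈ᶠ F) (sym (unique y 0 1 My (BW-matched (σ y) (∈ᶠ⇒BW {F} (σ-black black) σy∈F)))) σy∈F

      downFlip-≤ : ∀ F {M N y} → DownFlip G F M N → Black y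
                 → bit (onFace F y) + bit (N y) ≤ bit (onFace F (σ y)) + bit (M y)
      downFlip-≤ F {M} {y = y} flip black rewrite flipped-at-black F flip black =
        flip-count-≤ (onFace F y) (onFace F (σ y)) (M y) (matched-on-face F flip black)

      downFlip-≡ : ∀ F {M N y} → IsPM G M → DownFlip G F M N → Black y
                 → bit (onFace F y) + bit (N y) ≡ bit (onFace F (σ y)) + bit (M y)
      downFlip-≡ F {M} {y = y} M-pm flip black rewrite flipped-at-black F flip black =
        flip-count-≡ (onFace F y) (onFace F (σ y)) (M y) (matched-on-face F flip black)
          (λ on-σy My → onFace-true F (perfect-on-face F M-pm flip black (onFace-true⁻ F on-σy) My))

      height-chain : ∀ {Z M fs} → SatChain G Z M fs → IsPM G M → ∀ {y} → Black y
                   → flips fs y + bit (Z y) ≡ flips fs (σ y) + bit (M y)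
      height-chain (start M≐Z)                _    {y} _     = cong bit (sym (M≐Z y))
      height-chain {fs = _ ∷ fs} (next F chain N-pm _ flip) M-pm {y} black =
        telescope-≡ (flips fs y) (flips fs (σ y)) (bit (onFace F y)) (bit (onFace F (σ y)))
          (height-chain chain N-pm black) (downFlip-≡ F M-pm flip black)

      faces : ∀ {M M′} → _≼_ G M M′ → List (Face G)
      faces (done _)     = []
      faces (step F _ P) = F ∷ faces P

      height-≼ : ∀ {M M′} (P : _≼_ G M M′) → ∀ {y} → Black y
               → flips (faces P) y + bit (M y) ≤ flips (faces P) (σ y) + bit (M′ y)
      height-≼ (done M≐M′)    {y} _     = ≤-reflexive (cong bit (M≐M′ y))
      height-≼ (step F flip P) {y} black =
        telescope-≤ (flips (faces P) y) (flips (faces P) (σ y)) (bit (onFace F y)) (bit (onFace F (σ y)))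
          (height-≼ P black) (downFlip-≤ F flip black)

      -- Around a black dart the flip count n can only grow, so it is constant around each vertex;
      -- being constant on faces too, it equals its value 0 on the outer face.
      ≼-cycle⇒flips≡0 : ∀ {M M′} (P : _≼_ G M M′) → _≼_ G M′ M → ∀ d → flips (faces P) d ≡ 0
      ≼-cycle⇒flips≡0 {M} P Q d = m+n≡0⇒n≡0 (flips (faces Q) d) (trans (invariant⇒constant n n-φ n-σ d) n-outer)
        where
        n : Dart → ℕ
        n d = flips (faces Q) d + flips (faces P) d
        n-φ : ∀ d → n (φ d) ≡ n d
        n-φ d = cong₂ _+_ (flips-orbit (faces Q) (orbit-sym (orbit-step d))) (flips-orbit (faces P) (orbit-sym (orbit-step d)))
        n-≤ : ∀ {y} → Black y → n y ≤ n (σ y)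
        n-≤ {y} black = +-cancelʳ-≤ (bit (M y)) (n y) (n (σ y))
          (telescope-≤ (flips (faces P) y) (flips (faces P) (σ y)) (flips (faces Q) y) (flips (faces Q) (σ y))
            (height-≼ P black) (height-≼ Q black))
        n-σ : ∀ {y} → Black y → n y ≡ n (σ y)
        n-σ = Vertices.nondecreasing⇒invariant σ-black n n-≤
        n-outer : n outer ≡ 0
        n-outer = cong₂ _+_ (flips-outer (faces Q) (0 , refl)) (flips-outer (faces P) (0 , refl))

      ≼-cycle⇒bit≤ : ∀ {M M′} → _≼_ G M M′ → _≼_ G M′ M → ∀ {y} → Black y → bit (M y) ≤ bit (M′ y)
      ≼-cycle⇒bit≤ {M} {M′} P Q {y} black = begin
        bit (M y)                               ≤⟨ m≤n+m _ _ ⟩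
        flips (faces P) y + bit (M y)           ≤⟨ height-≼ P black ⟩
        flips (faces P) (σ y) + bit (M′ y)      ≡⟨ cong (_+ bit (M′ y)) (≼-cycle⇒flips≡0 P Q (σ y)) ⟩
        bit (M′ y)                              ∎
        where open ≤-Reasoning

      ≼-antisym-black : ∀ {M M′} → _≼_ G M M′ → _≼_ G M′ M → ∀ {y} → Black y → M y ≡ M′ y
      ≼-antisym-black P Q black = bit-injective (≼-cycle⇒bit≤ P Q black) (≼-cycle⇒bit≤ Q P black)

      minimum-unique : ∀ {Z Z′} → IsMinimum G Z → IsMinimum G Z′ → ∀ {y} → Black y → Z y ≡ Z′ y
      minimum-unique (Z-pm , Z-min) (Z′-pm , Z′-min) = ≼-antisym-black (Z-min _ Z′-pm) (Z′-min _ Z-pm)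

module _ where
  open import Data.Integer as ℤ using (+_; -[1+_])
  import Data.Integer.Properties as ℤ
  import Data.Nat as ℕ
  open import Data.Nat.Coprimality using (1-coprimeTo) renaming (sym to coprime-sym)
  open import Data.Rational using (ℚ; mkℚ; 0ℚ; 1ℚ; _/_; _+_; _*_; _-_; -_; _≤_; _<_; *≤*; nonNegative; positive)
  open import Data.Rational.Properties
    using (normalize-coprime; ≤-refl; ≤-antisym; <⇒≤; +-mono-≤; +-monoˡ-≤; +-monoʳ-≤; +-monoˡ-<;
           *-monoˡ-≤-nonNeg; *-cancelˡ-≤-pos; ≤-reflexive; *-zeroʳ; *-identityʳ; +-identityʳ; +-inverseʳ; +-0-group)
  open import Algebra.Properties.Group +-0-group using (x∙y⁻¹≈ε⇒x≈y)
  open import Data.Rational.Solver using (module +-*-Solver)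
  open +-*-Solver using (solve; _:=_; _:+_; _:-_; _:*_; con)

  _∈[0,1] : ℚ → Set
  q ∈[0,1] = 0ℚ ≤ q × q ≤ 1ℚ

  -- i / 1 normalises through a gcd computation, so it is first rewritten to a literal fraction.
  mkℚ₁ : ℤ → ℚ
  mkℚ₁ i = mkℚ i 0 (coprime-sym (1-coprimeTo ℤ.∣ i ∣))

  /1≡mkℚ₁ : ∀ i → i / 1 ≡ mkℚ₁ i
  /1≡mkℚ₁ (+ n)    = normalize-coprime (coprime-sym (1-coprimeTo n))
  /1≡mkℚ₁ -[1+ n ] = cong -_ (normalize-coprime (coprime-sym (1-coprimeTo (suc n))))

  /1-+ : ∀ i j → (i ℤ.+ j) / 1 ≡ i / 1 + j / 1
  /1-+ i j rewrite /1≡mkℚ₁ i | /1≡mkℚ₁ j =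
    cong (_/ 1) (sym (cong₂ ℤ._+_ (ℤ.*-identityʳ i) (ℤ.*-identityʳ j)))

  /1-neg : ∀ i → (ℤ.- i) / 1 ≡ - (i / 1)
  /1-neg i rewrite /1≡mkℚ₁ i | /1≡mkℚ₁ (ℤ.- i) = mkℚ₁-neg i
    where
    mkℚ₁-neg : ∀ i → mkℚ₁ (ℤ.- i) ≡ - mkℚ₁ i
    mkℚ₁-neg (+ zero)  = refl
    mkℚ₁-neg (+ suc n) = refl
    mkℚ₁-neg -[1+ n ]  = refl

  /1-∈[0,1] : ∀ i → (i / 1) ∈[0,1] → i / 1 ≡ 0ℚ ⊎ i / 1 ≡ 1ℚ
  /1-∈[0,1] i rewrite /1≡mkℚ₁ i = mkℚ₁-∈[0,1] i
    where
    mkℚ₁-∈[0,1] : ∀ i → mkℚ₁ i ∈[0,1] → mkℚ₁ i ≡ 0ℚ ⊎ mkℚ₁ i ≡ 1ℚ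
    mkℚ₁-∈[0,1] (+ zero)        _ = inj₁ refl
    mkℚ₁-∈[0,1] (+ suc zero)    _ = inj₂ refl
    mkℚ₁-∈[0,1] (+ suc (suc n)) (_ , *≤* (ℤ.+≤+ (ℕ.s≤s ())))
    mkℚ₁-∈[0,1] -[1+ n ]        (*≤* () , _)

  ℕ/1-difference : ∀ {a b m z} → a ℕ.+ z ≡ b ℕ.+ m → + a / 1 - + b / 1 + + z / 1 ≡ + m / 1
  ℕ/1-difference {a} {b} {m} {z} a+z≡b+m = begin
    + a / 1 - + b / 1 + + z / 1      ≡⟨ solve 3 (λ a b z → a :- b :+ z := (a :+ z) :- b) refl (+ a / 1) (+ b / 1) (+ z / 1) ⟩
    (+ a / 1 + + z / 1) - + b / 1    ≡⟨ cong (_- + b / 1) (sym (/1-+ (+ a) (+ z))) ⟩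
    + (a ℕ.+ z) / 1 - + b / 1        ≡⟨ cong (λ k → + k / 1 - + b / 1) a+z≡b+m ⟩
    + (b ℕ.+ m) / 1 - + b / 1        ≡⟨ cong (_- + b / 1) (/1-+ (+ b) (+ m)) ⟩
    (+ b / 1 + + m / 1) - + b / 1    ≡⟨ solve 2 (λ b m → (b :+ m) :- b := m) refl (+ b / 1) (+ m / 1) ⟩
    + m / 1                          ∎
    where open ≡-Reasoning

  0≤1 : 0ℚ ≤ 1ℚ
  0≤1 = *≤* (ℤ.+≤+ ℕ.z≤n)

  0≤- : ∀ {p q} → p ≤ q → 0ℚ ≤ q - p
  0≤- {p} {q} p≤q = subst (_≤ q - p) (+-inverseʳ p) (+-monoˡ-≤ (- p) p≤q)

  0<- : ∀ {p q} → p < q → 0ℚ < q - p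
  0<- {p} {q} p<q = subst (_< q - p) (+-inverseʳ p) (+-monoˡ-< (- p) p<q)

  0≤* : ∀ {p q} → 0ℚ ≤ p → 0ℚ ≤ q → 0ℚ ≤ p * q
  0≤* {p} {q} 0≤p 0≤q = subst (_≤ p * q) (*-zeroʳ p) (*-monoˡ-≤-nonNeg p {{nonNegative 0≤p}} 0≤q)

  nonNeg+nonNeg≡0 : ∀ {p q} → 0ℚ ≤ p → 0ℚ ≤ q → p + q ≡ 0ℚ → p ≡ 0ℚ
  nonNeg+nonNeg≡0 {p} {q} 0≤p 0≤q p+q≡0 =
    ≤-antisym (subst₂ _≤_ (+-identityʳ p) p+q≡0 (+-monoʳ-≤ p 0≤q)) 0≤p

  pos*nonNeg≡0 : ∀ {p q} → 0ℚ < p → 0ℚ ≤ q → p * q ≡ 0ℚ → q ≡ 0ℚ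
  pos*nonNeg≡0 {p} {q} 0<p 0≤q pq≡0 =
    ≤-antisym (*-cancelˡ-≤-pos p {{positive 0<p}} (subst (p * q ≤_) (sym (*-zeroʳ p)) (≤-reflexive pq≡0))) 0≤q

  convex≡0 : ∀ {t u v} → 0ℚ < t → t < 1ℚ → 0ℚ ≤ u → 0ℚ ≤ v → t * u + (1ℚ - t) * v ≡ 0ℚ → u ≡ v
  convex≡0 {t} {u} {v} 0<t t<1 0≤u 0≤v sum≡0 = trans (pos*nonNeg≡0 0<t 0≤u tu≡0) (sym (pos*nonNeg≡0 (0<- t<1) 0≤v sv≡0))
    where
    0≤tu = 0≤* (<⇒≤ 0<t) 0≤u
    0≤sv = 0≤* (<⇒≤ (0<- t<1)) 0≤v
    tu≡0 = nonNeg+nonNeg≡0 0≤tu 0≤sv sum≡0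
    sv≡0 = nonNeg+nonNeg≡0 0≤sv 0≤tu (trans (solve 2 (λ a b → b :+ a := a :+ b) refl (t * u) ((1ℚ - t) * v)) sum≡0)

  ∈[0,1]-extreme : ∀ {t u v w} → 0ℚ < t → t < 1ℚ → u ∈[0,1] → v ∈[0,1]
                 → w ≡ 0ℚ ⊎ w ≡ 1ℚ → w ≡ t * u + (1ℚ - t) * v → u ≡ v
  ∈[0,1]-extreme 0<t t<1 (0≤u , _) (0≤v , _) (inj₁ w≡0) w≡ = convex≡0 0<t t<1 0≤u 0≤v (trans (sym w≡) w≡0)
  ∈[0,1]-extreme {t} {u} {v} 0<t t<1 (_ , u≤1) (_ , v≤1) (inj₂ w≡1) w≡ =
    begin
      u             ≡⟨ solve 1 (λ u → u := con 1ℚ :- (con 1ℚ :- u)) refl u ⟩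
      1ℚ - (1ℚ - u) ≡⟨ cong (λ q → 1ℚ - q) (convex≡0 0<t t<1 (0≤- u≤1) (0≤- v≤1) mirrored≡0) ⟩
      1ℚ - (1ℚ - v) ≡⟨ solve 1 (λ v → con 1ℚ :- (con 1ℚ :- v) := v) refl v ⟩
      v             ∎
    where
    open ≡-Reasoning
    mirrored≡0 : t * (1ℚ - u) + (1ℚ - t) * (1ℚ - v) ≡ 0ℚ
    mirrored≡0 = begin
      t * (1ℚ - u) + (1ℚ - t) * (1ℚ - v) ≡⟨ solve 3 (λ t u v → t :* (con 1ℚ :- u) :+ (con 1ℚ :- t) :* (con 1ℚ :- v)
                                                  := con 1ℚ :- (t :* u :+ (con 1ℚ :- t) :* v)) refl t u v ⟩
      1ℚ - (t * u + (1ℚ - t) * v)          ≡⟨ cong (λ q → 1ℚ - q) (trans (sym w≡) w≡1) ⟩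
      1ℚ - 1ℚ                              ≡⟨ +-inverseʳ 1ℚ ⟩
      0ℚ                                   ∎

  module _ {A : Set} where

    combine : List (ℚ × A) → (A → ℚ) → ℚ
    combine L h = foldr (λ p acc → proj₁ p * h (proj₂ p) + acc) 0ℚ L

    totalWeight : List (ℚ × A) → ℚ
    totalWeight L = foldr (λ p acc → proj₁ p + acc) 0ℚ L

    combine-zero : ∀ L → combine L (λ _ → 0ℚ) ≡ 0ℚ
    combine-zero []       = refl
    combine-zero (p ∷ L) = trans (cong₂ _+_ (*-zeroʳ (proj₁ p)) (combine-zero L)) (+-identityʳ 0ℚ)

    combine-cong : ∀ {h₁ h₂ : A → ℚ} {L} → All (λ p → h₁ (proj₂ p) ≡ h₂ (proj₂ p)) L → combine L h₁ ≡ combine L h₂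
    combine-cong []            = refl
    combine-cong {L = (ω , _) ∷ _} (eq ∷ eqs) = cong₂ (λ a b → ω * a + b) eq (combine-cong eqs)

    combine-affine : ∀ L (h₁ h₂ : A → ℚ) c → combine L h₁ - combine L h₂ + c * totalWeight L ≡ combine L (λ v → h₁ v - h₂ v + c)
    combine-affine []             h₁ h₂ c = solve 1 (λ c → con 0ℚ :- con 0ℚ :+ c :* con 0ℚ := con 0ℚ) refl c
    combine-affine ((ω , v) ∷ L) h₁ h₂ c = begin
      (ω * h₁ v + combine L h₁) - (ω * h₂ v + combine L h₂) + c * (ω + totalWeight L)
        ≡⟨ solve 7 (λ ω a b c s₁ s₂ w → (ω :* a :+ s₁) :- (ω :* b :+ s₂) :+ c :* (ω :+ w)
                                       := ω :* (a :- b :+ c) :+ (s₁ :- s₂ :+ c :* w))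
                   refl ω (h₁ v) (h₂ v) c (combine L h₁) (combine L h₂) (totalWeight L) ⟩
      ω * (h₁ v - h₂ v + c) + (combine L h₁ - combine L h₂ + c * totalWeight L)
        ≡⟨ cong (λ q → ω * (h₁ v - h₂ v + c) + q) (combine-affine L h₁ h₂ c) ⟩
      ω * (h₁ v - h₂ v + c) + combine L (λ v → h₁ v - h₂ v + c) ∎
      where open ≡-Reasoning

    combine-bounds : ∀ {h : A → ℚ} {L} → All (λ p → 0ℚ ≤ proj₁ p × h (proj₂ p) ∈[0,1]) L
                   → 0ℚ ≤ combine L h × combine L h ≤ totalWeight L
    combine-bounds [] = ≤-refl , ≤-refl
    combine-bounds {h} {(ω , v) ∷ L} ((0≤ω , 0≤hv , hv≤1) ∷ rest) with combine-bounds rest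
    ... | 0≤rest , rest≤total =
      subst (_≤ ω * h v + combine L h) (+-identityʳ 0ℚ) (+-mono-≤ (0≤* 0≤ω 0≤hv) 0≤rest) ,
      +-mono-≤ (subst (ω * h v ≤_) (*-identityʳ ω) (*-monoˡ-≤-nonNeg ω {{nonNegative 0≤ω}} hv≤1)) rest≤total

    combine-∈[0,1] : ∀ {h : A → ℚ} {L} → All (λ p → 0ℚ ≤ proj₁ p × h (proj₂ p) ∈[0,1]) L
                   → totalWeight L ≡ 1ℚ → combine L h ∈[0,1]
    combine-∈[0,1] {h} {L} bounds total≡1 with combine-bounds bounds
    ... | 0≤ , ≤total = 0≤ , subst (combine L h ≤_) total≡1 ≤total

  module _ (G : PlaneBipartiteGraph) where
    open PlaneBipartiteGraph G

    module Newton (α-involutive : ∀ d → α (α d) ≡ d)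
                  (σ-injective : ∀ d e → σ d ≡ σ e → d ≡ e)
                  (connected : ∀ d e → Reach α σ d e)
                  (colour-σ : ∀ d → colour (σ d) ≡ colour d)
                  (colour-α : ∀ d → colour (α d) ≡ not (colour d)) where

      open Heights G α-involutive σ-injective connected colour-σ colour-α

      onDarts : Point G → Dart → ℚ
      onDarts = extend 0ℚ

      edgeWeight : Matching G → Point G → Dart → ℚ
      edgeWeight Z w y = onDarts w y - onDarts w (σ y) + ℕtoℚ G (bit (Z y))

      asPoint : ExpVec G → Point G
      asPoint v f = ℕtoℚ G (v f)

      bit∈[0,1] : ∀ b → ℕtoℚ G (bit b) ∈[0,1]
      bit∈[0,1] true  = 0≤1 , ≤-refl
      bit∈[0,1] false = ≤-refl , 0≤1

      support-extend≡flips : ∀ {v fs} → (∀ f → v f ≡ mult G fs f) → ∀ d → extend 0 v d ≡ flips fs d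
      support-extend≡flips {v} {fs} v≡ d with locate d
      ... | bounded F d∈F     = trans (v≡ F) (trans (mult-flips fs F) (flips-orbit fs d∈F))
      ... | unbounded outer~d = sym (flips-outer fs outer~d)

      support-respectsRep : ∀ {v} → InSupport G v → RespectsRep v
      support-respectsRep {v} (_ , _ , _ , _ , fs , _ , v≡) {F} {F′} r≡r′ = begin
        v F                   ≡⟨ trans (v≡ F) (mult-flips fs F) ⟩
        flips fs (proj₁ F)    ≡⟨ cong (flips fs) r≡r′ ⟩
        flips fs (proj₁ F′)   ≡⟨ trans (v≡ F′) (mult-flips fs F′) ⟨
        v F′                  ∎
        where open ≡-Reasoning

      support-edgeWeight : ∀ {Z₀ v} → IsMinimum G Z₀ → InSupport G v → ∀ {y} → Black y
                         → edgeWeight Z₀ (asPoint v) y ∈[0,1]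
      support-edgeWeight {Z₀} {v} Z₀-min (Z , Z-min , M , M-pm , fs , chain , v≡) {y} black =
        subst _∈[0,1] (sym edgeWeight≡) (bit∈[0,1] (M y))
        where
        heights : extend 0 v y ℕ.+ bit (Z₀ y) ≡ extend 0 v (σ y) ℕ.+ bit (M y)
        heights = begin
          extend 0 v y ℕ.+ bit (Z₀ y)     ≡⟨ cong₂ ℕ._+_ (support-extend≡flips {fs = fs} v≡ y) (cong bit (minimum-unique Z₀-min Z-min black)) ⟩
          flips fs y ℕ.+ bit (Z y)        ≡⟨ height-chain chain M-pm black ⟩
          flips fs (σ y) ℕ.+ bit (M y)    ≡⟨ cong (ℕ._+ bit (M y)) (support-extend≡flips {fs = fs} v≡ (σ y)) ⟨
          extend 0 v (σ y) ℕ.+ bit (M y)  ∎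
          where open ≡-Reasoning
        edgeWeight≡ : edgeWeight Z₀ (asPoint v) y ≡ ℕtoℚ G (bit (M y))
        edgeWeight≡ = trans (cong₂ (λ a b → a - b + ℕtoℚ G (bit (Z₀ y))) (extend-map (ℕtoℚ G) {z = 0} {w = v} y) (extend-map (ℕtoℚ G) {z = 0} {w = v} (σ y)))
                            (ℕ/1-difference {extend 0 v y} {extend 0 v (σ y)} {bit (M y)} {bit (Z₀ y)} heights)

      newton-minimum : ∀ {x} → InNewton G x → Σ (Matching G) (IsMinimum G)
      newton-minimum ([]    , _                             , () , _)
      newton-minimum (_ ∷ _ , (_ , Z , Z-min , _) ∷ _ , _  , _) = Z , Z-min

      newton-respectsRep : ∀ {x} → InNewton G x → RespectsRep x
      newton-respectsRep (L , weighted , _ , x≡) {F} {F′} r≡r′ =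
        trans (x≡ F) (trans (combine-cong (All.map (λ (_ , sup) → cong (ℕtoℚ G) (support-respectsRep sup r≡r′)) weighted))
                            (sym (x≡ F′)))

      onDarts-combine : ∀ {x} → (x∈N : InNewton G x) → ∀ d → onDarts x d ≡ combine (proj₁ x∈N) (λ v → onDarts (asPoint v) d)
      onDarts-combine (L , _ , _ , x≡) d with locate d
      ... | bounded F _ = x≡ F
      ... | unbounded _ = sym (combine-zero L)

      newton-edgeWeight : ∀ {x Z₀} → InNewton G x → IsMinimum G Z₀ → ∀ {y} → Black y → edgeWeight Z₀ x y ∈[0,1]
      newton-edgeWeight {x} {Z₀} x∈N@(L , weighted , total≡1 , _) Z₀-min {y} black =
        subst _∈[0,1] (sym edgeWeight≡)
          (combine-∈[0,1] (All.map (λ (0≤ω , sup) → 0≤ω , support-edgeWeight Z₀-min sup black) weighted) total≡1)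
        where
        z = ℕtoℚ G (bit (Z₀ y))
        at-y at-σy : ExpVec G → ℚ
        at-y  v = onDarts (asPoint v) y
        at-σy v = onDarts (asPoint v) (σ y)
        edgeWeight≡ : edgeWeight Z₀ x y ≡ combine L (λ v → edgeWeight Z₀ (asPoint v) y)
        edgeWeight≡ = begin
          onDarts x y - onDarts x (σ y) + z
            ≡⟨ cong₂ (λ a b → a - b + z) (onDarts-combine x∈N y) (onDarts-combine x∈N (σ y)) ⟩
          combine L at-y - combine L at-σy + z
            ≡⟨ cong (λ w → combine L at-y - combine L at-σy + w) (trans (cong (z *_) total≡1) (*-identityʳ z)) ⟨
          combine L at-y - combine L at-σy + z * totalWeight L
            ≡⟨ combine-affine L at-y at-σy z ⟩
          combine L (λ v → edgeWeight Z₀ (asPoint v) y) ∎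
          where open ≡-Reasoning

      edgeWeight-integral : (p : Face G → ℤ) (Z : Matching G) (y : Dart)
        → ∃ λ k → edgeWeight Z (λ f → ℤtoℚ G (p f)) y ≡ k / 1
      edgeWeight-integral p Z y = i ℤ.- j ℤ.+ + bit (Z y) , (begin
        onDarts (λ f → p f / 1) y - onDarts (λ f → p f / 1) (σ y) + + bit (Z y) / 1
          ≡⟨ cong₂ (λ a b → a - b + + bit (Z y) / 1) (extend-map (_/ 1) y) (extend-map (_/ 1) (σ y)) ⟩
        i / 1 - j / 1 + + bit (Z y) / 1
          ≡⟨ cong (λ b → i / 1 + b + + bit (Z y) / 1) (/1-neg j) ⟨
        i / 1 + (ℤ.- j) / 1 + + bit (Z y) / 1
          ≡⟨ cong (_+ + bit (Z y) / 1) (/1-+ i (ℤ.- j)) ⟨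
        (i ℤ.- j) / 1 + + bit (Z y) / 1
          ≡⟨ /1-+ (i ℤ.- j) (+ bit (Z y)) ⟨
        (i ℤ.- j ℤ.+ + bit (Z y)) / 1 ∎)
        where
        open ≡-Reasoning
        i = extend (+ 0) p y
        j = extend (+ 0) p (σ y)

      integral-edgeWeight-01 : (p : Face G → ℤ) → InNewton G (λ f → ℤtoℚ G (p f)) → ∀ {Z} → IsMinimum G Z → ∀ {y} → Black y
        → edgeWeight Z (λ f → ℤtoℚ G (p f)) y ≡ 0ℚ ⊎ edgeWeight Z (λ f → ℤtoℚ G (p f)) y ≡ 1ℚ
      integral-edgeWeight-01 p x∈N {Z} Z-min {y} black with edgeWeight-integral p Z y
      ... | k , weight≡k =
        subst (λ q → q ≡ 0ℚ ⊎ q ≡ 1ℚ) (sym weight≡k) (/1-∈[0,1] k (subst _∈[0,1] weight≡k (newton-edgeWeight x∈N Z-min black)))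

      edgeWeight-convex : ∀ {x} a c t → (∀ f → x f ≡ t * a f + (1ℚ - t) * c f) → ∀ Z y
        → edgeWeight Z x y ≡ t * edgeWeight Z a y + (1ℚ - t) * edgeWeight Z c y
      edgeWeight-convex {x} a c t x≡ Z y = begin
        onDarts x y - onDarts x (σ y) + z
          ≡⟨ cong₂ (λ p q → p - q + z) (onDarts-convex y) (onDarts-convex (σ y)) ⟩
        (t * onDarts a y + (1ℚ - t) * onDarts c y) - (t * onDarts a (σ y) + (1ℚ - t) * onDarts c (σ y)) + z
          ≡⟨ solve 6 (λ t ay cy aσ cσ z → (t :* ay :+ (con 1ℚ :- t) :* cy) :- (t :* aσ :+ (con 1ℚ :- t) :* cσ) :+ z
                                        := t :* (ay :- aσ :+ z) :+ (con 1ℚ :- t) :* (cy :- cσ :+ z))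
                     refl t (onDarts a y) (onDarts c y) (onDarts a (σ y)) (onDarts c (σ y)) z ⟩
        t * edgeWeight Z a y + (1ℚ - t) * edgeWeight Z c y ∎
        where
        open ≡-Reasoning
        z = ℕtoℚ G (bit (Z y))
        onDarts-convex : ∀ d → onDarts x d ≡ t * onDarts a d + (1ℚ - t) * onDarts c d
        onDarts-convex d with locate d
        ... | bounded F _ = x≡ F
        ... | unbounded _ = solve 1 (λ t → con 0ℚ := t :* con 0ℚ :+ (con 1ℚ :- t) :* con 0ℚ) refl t

      edgeWeights-determine : ∀ {a c Z} → InNewton G a → InNewton G c
        → (∀ {y} → Black y → edgeWeight Z a y ≡ edgeWeight Z c y) → ∀ f → a f ≡ c f
      edgeWeights-determine {a} {c} {Z} a∈N c∈N same-weights F = begin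
        a F                ≡⟨ extend-face (newton-respectsRep a∈N) (0 , refl) ⟨
        onDarts a (proj₁ F) ≡⟨ x∙y⁻¹≈ε⇒x≈y _ _ (trans (invariant⇒constant difference difference-φ difference-black (proj₁ F)) difference-outer) ⟩
        onDarts c (proj₁ F) ≡⟨ extend-face (newton-respectsRep c∈N) (0 , refl) ⟩
        c F                ∎
        where
        open ≡-Reasoning
        difference : Dart → ℚ
        difference d = onDarts a d - onDarts c d
        difference-φ : ∀ d → difference (φ d) ≡ difference d
        difference-φ d = cong₂ _-_ (extend-φ (newton-respectsRep a∈N) d) (extend-φ (newton-respectsRep c∈N) d)
        difference-black : ∀ {y} → Black y → difference y ≡ difference (σ y)
        difference-black {y} black = begin
          difference y
            ≡⟨ solve 5 (λ ay cy aσ cσ z → ay :- cy := (aσ :- cσ) :+ ((ay :- aσ :+ z) :- (cy :- cσ :+ z))) refl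
                       (onDarts a y) (onDarts c y) (onDarts a (σ y)) (onDarts c (σ y)) (ℕtoℚ G (bit (Z y))) ⟩
          difference (σ y) + (edgeWeight Z a y - edgeWeight Z c y)
            ≡⟨ cong (λ e → difference (σ y) + (e - edgeWeight Z c y)) (same-weights black) ⟩
          difference (σ y) + (edgeWeight Z c y - edgeWeight Z c y)
            ≡⟨ cong (λ e → difference (σ y) + e) (+-inverseʳ (edgeWeight Z c y)) ⟩
          difference (σ y) + 0ℚ
            ≡⟨ +-identityʳ (difference (σ y)) ⟩
          difference (σ y) ∎
        difference-outer : difference outer ≡ 0ℚ
        difference-outer = trans (cong₂ _-_ (extend-outer (0 , refl)) (extend-outer (0 , refl))) (+-inverseʳ 0ℚ)

corollary3p9 : (G : PlaneBipartiteGraph) → Star G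
    → (p : Face G → ℤ) → InNewton G (λ f → ℤtoℚ G (p f))
    → IsVertex G (λ f → ℤtoℚ G (p f))
corollary3p9 G ((α-involutive , _ , σ-injective , connected , _ , colour-σ , colour-α) , _) p x∈N =
  x∈N , λ a c t a∈N c∈N 0<t t<1 x≡ta+[1-t]c →
    edgeWeights-determine {Z = Z₀} a∈N c∈N λ black →
      ∈[0,1]-extreme 0<t t<1 (newton-edgeWeight a∈N Z₀-min black) (newton-edgeWeight c∈N Z₀-min black)
        (integral-edgeWeight-01 p x∈N Z₀-min black) (edgeWeight-convex a c t x≡ta+[1-t]c Z₀ _)
  where
  open Newton G α-involutive σ-injective connected colour-σ colour-α
  Z₀ = proj₁ (newton-minimum x∈N)
  Z₀-min = proj₂ (newton-minimum x∈N)
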